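{- Let $\sigma\ge2$ be an even integer. Then $z(w_\sigma^R)=2\sigma-1$.
   Context: Let $\Sigma=\{a_1,\dots,a_\sigma\}$ with $a_1<\cdots<a_\sigma$, and $w_\sigma=\left(\prod_{i=1}^{\sigma-1}a_ia_{i+1}\right)\left(\prod_{i=1}^{\sigma}a_i\right)$ (concatenation in increasing $i$); $w_\sigma^R$ is its reverse. The Lempel–Ziv parse of a string $w$ is the factorization $w=x_1\cdots x_z$ in which each phrase $x_j$ is the longest prefix of $x_j\cdots x_z$ having another occurrence in $w$ starting at a position $i\le|x_1\cdots x_{j-1}|$ (overlaps allowed), or a single character if no nonempty such prefix exists; $z(w)$ is the number of phrases. -}

module Defs where

open import Data.Nat using (ℕ; zero; suc; _+_; _∸_; _<ᵇ_; _≡ᵇ_)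
open import Data.Bool using (Bool; true; false; _∧_; _∨_; if_then_else_)
open import Data.List using (List; []; _∷_; _++_; length; take; drop; concatMap; reverse; map)
open import Data.List using (upTo)

-- Alphabet: the letter a_i is represented by the natural number i (1 ≤ i ≤ σ),
-- so the order a_1 < ... < a_σ is the usual order on ℕ.

pairsPart : ℕ → List ℕ
pairsPart σ = concatMap (λ j → suc j ∷ suc (suc j) ∷ []) (upTo (σ ∸ 1))

w : ℕ → List ℕ
w σ = pairsPart σ ++ map suc (upTo σ)

isPrefix : List ℕ → List ℕ → Bool
isPrefix [] _ = true
isPrefix (_ ∷ _) [] = false
isPrefix (a ∷ x) (b ∷ y) = (a ≡ᵇ b) ∧ isPrefix x y

-- occursBefore s x p : x occurs in s at some (0-based) start position i < p
-- (the occurrence may overlap position p and beyond)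
occursBefore : List ℕ → List ℕ → ℕ → Bool
occursBefore s x p = go 0 p
  where
  go : ℕ → ℕ → Bool
  go i zero = false
  go i (suc k) = isPrefix x (drop i s) ∨ go (suc i) k

-- Length of the LZ phrase starting at (0-based) position p of s:
-- the largest ℓ with 1 ≤ ℓ ≤ |s| - p such that s[p .. p+ℓ) occurs in s
-- starting at some i < p; 1 if there is no such ℓ.
phraseLen : List ℕ → ℕ → ℕ
phraseLen s p = search (length s ∸ p)
  where
  search : ℕ → ℕ
  search zero = 1
  search (suc ℓ) =
    if occursBefore s (take (suc ℓ) (drop p s)) p then suc ℓ else search ℓ

-- The LZ parse of s, computed greedily from position p, with fuel
-- (each phrase has length ≥ 1, so |s| steps of fuel suffice).
lzFrom : List ℕ → ℕ → ℕ → List (List ℕ)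
lzFrom s zero p = []
lzFrom s (suc fuel) p =
  if p <ᵇ length s
  then take (phraseLen s p) (drop p s) ∷ lzFrom s fuel (p + phraseLen s p)
  else []

lzParse : List ℕ → List (List ℕ)
lzParse s = lzFrom s (length s) 0

z : List ℕ → ℕ
z s = length (lzParse s)

-- Write σ = m + 1. Then reverse (w σ) is
--   wᴿ m = σ (σ − 1) ⋯ 1 · σ (σ − 1) · (σ − 1) (σ − 2) ⋯ 2 1.
-- Each letter of the leading run is new, so the run is parsed into σ phrases of length one.
-- Each of the σ − 1 following pairs (c + 1) c already occurs in the run, so its phrase has length
-- at least two; it has length exactly two because the next letter is again c, and the square c c
-- occurs in wᴿ m only at that one place.
module Submission where

open import Defs
open import Data.Nat
  using (ℕ; _≤_; _*_; _∸_; zero; suc; _+_; _<_; _<ᵇ_; _⊓_; _≤′_; ≤′-refl; ≤′-step; z≤n; s≤s; z<s; s<s)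
open import Data.Nat.Divisibility using (_∣_)
open import Data.List
  using (reverse; List; []; _∷_; _++_; length; take; drop; map; concatMap; upTo; downFrom; applyUpTo; applyDownFrom)
open import Relation.Binary.PropositionalEquality
  using (_≡_; _≢_; refl; sym; trans; cong; cong₂; subst; module ≡-Reasoning)

open import Data.Bool using (Bool; true; false; T; _∨_)
open import Data.Bool.Properties using (T-∧; T-∨; T-≡)
open import Data.Empty using (⊥-elim)
open import Data.List.Properties
  using ( ∷-injectiveˡ; ++-assoc; ++-identityʳ; concatMap-++; unfold-reverse; reverse-++; map-upTo
        ; reverse-applyUpTo; reverse-upTo; take-take; take++drop≡id; length-drop; length-++; length-applyDownFrom)
open import Data.Nat.Properties
open import Data.Product using (∃-syntax; _×_; _,_)
open import Data.Sum using (inj₁; inj₂)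
open import Data.Unit using (tt)
open import Function using (_∘_; _⇔_; mk⇔; Equivalence)
open import Relation.Nullary using (¬_)

OccursAt : List ℕ → List ℕ → ℕ → Set
OccursAt s x j = ∃[ u ] drop j s ≡ x ++ u

OccursBefore : List ℕ → List ℕ → ℕ → Set
OccursBefore s x p = ∃[ j ] j < p × OccursAt s x j

isPrefix-sound : ∀ x t → T (isPrefix x t) → ∃[ u ] t ≡ x ++ u
isPrefix-sound []      t       _ = t , refl
isPrefix-sound (a ∷ x) (b ∷ t) h with Equivalence.to T-∧ h
... | a≡ᵇb , x⊑t with ≡ᵇ⇒≡ a b a≡ᵇb | isPrefix-sound x t x⊑t
...   | refl | u , refl = u , refl

isPrefix-complete : ∀ x u → T (isPrefix x (x ++ u))
isPrefix-complete []      u = tt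
isPrefix-complete (a ∷ x) u = Equivalence.from T-∧ (≡⇒≡ᵇ a a refl , isPrefix-complete x u)

-- Defs computes occursBefore and phraseLen with helpers local to where-blocks, which cannot be
-- named here. occursBetween and phraseLenUpTo are these helpers (the third argument of
-- occursBetween is the unused p of occursBefore): each is a metavariable, solved by unification
-- in the equation after it, whose with-abstractions put the helper's arguments in pattern form.
mutual
  occursBetween : List ℕ → List ℕ → ℕ → ℕ → ℕ → Bool
  occursBetween s x p = _

  occursBefore-suc : ∀ s x k →
                     occursBefore s x (suc k) ≡ (isPrefix x s ∨ occursBetween s x (suc k) 1 k)
  occursBefore-suc s x k with 1 | suc k
  ... | i | p = refl

mutual
  phraseLenUpTo : List ℕ → ℕ → ℕ → ℕ
  phraseLenUpTo s p = _

  phraseLen-upTo : ∀ s p → phraseLen s p ≡ phraseLenUpTo s p (length s ∸ p)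
  phraseLen-upTo s p with length s ∸ p
  ... | n = refl

occursBefore-between : ∀ s x p → occursBefore s x p ≡ occursBetween s x p 0 p
occursBefore-between s x zero    = refl
occursBefore-between s x (suc k) = occursBefore-suc s x k

occursBetween-sound : ∀ s x p i k → T (occursBetween s x p i k) →
                      ∃[ j ] i ≤ j × j < i + k × OccursAt s x j
occursBetween-sound s x p i (suc k) h with Equivalence.to T-∨ h
... | inj₁ here  = i , ≤-refl , m<m+n i z<s , isPrefix-sound x (drop i s) here
... | inj₂ later with occursBetween-sound s x p (suc i) k later
...   | j , i<j , j<1+i+k , occ = j , <⇒≤ i<j , subst (j <_) (sym (+-suc i k)) j<1+i+k , occ

occursBetween-complete : ∀ s x p i k j → i ≤ j → j < i + k → OccursAt s x j →
                         T (occursBetween s x p i k)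
occursBetween-complete s x p i zero j i≤j j<i+0 _ =
  ⊥-elim (<-irrefl refl (≤-<-trans i≤j (subst (j <_) (+-identityʳ i) j<i+0)))
occursBetween-complete s x p i (suc k) j i≤j j<i+1+k (u , at-j) with m≤n⇒m<n∨m≡n i≤j
... | inj₂ refl = Equivalence.from T-∨ (inj₁ (subst (T ∘ isPrefix x) (sym at-j) (isPrefix-complete x u)))
... | inj₁ i<j  = Equivalence.from T-∨ (inj₂
      (occursBetween-complete s x p (suc i) k j i<j (subst (j <_) (+-suc i k) j<i+1+k) (u , at-j)))

occursBefore⇔ : ∀ s x p → T (occursBefore s x p) ⇔ OccursBefore s x p
occursBefore⇔ s x p rewrite occursBefore-between s x p = mk⇔ sound complete
  where
  sound : T (occursBetween s x p 0 p) → OccursBefore s x p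
  sound h with occursBetween-sound s x p 0 p h
  ... | j , _ , j<p , occ = j , j<p , occ
  complete : OccursBefore s x p → T (occursBetween s x p 0 p)
  complete (j , j<p , occ) = occursBetween-complete s x p 0 p j z≤n j<p occ

take-prefix : ∀ {m n} (y : List ℕ) → m ≤ n → ∃[ v ] take n y ≡ take m y ++ v
take-prefix {m} {n} y m≤n = rest , (begin
  take n y                     ≡⟨ take++drop≡id m (take n y) ⟨
  take m (take n y) ++ rest    ≡⟨ cong (_++ rest) (take-take m n y) ⟩
  take (m ⊓ n) y ++ rest       ≡⟨ cong (λ l → take l y ++ rest) (m≤n⇒m⊓n≡m m≤n) ⟩
  take m y ++ rest             ∎)
  where
  open ≡-Reasoning
  rest = drop m (take n y)

Recurs : List ℕ → ℕ → ℕ → Set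
Recurs s p ℓ = OccursBefore s (take ℓ (drop p s)) p

Recurs-antimono : ∀ {s p m n} → m ≤ n → Recurs s p n → Recurs s p m
Recurs-antimono {s} {p} {m} m≤n (j , j<p , u , at-j) with take-prefix (drop p s) m≤n
... | v , take-n =
  j , j<p , v ++ u , trans at-j (trans (cong (_++ u) take-n) (++-assoc (take m (drop p s)) v u))

module _ {s : List ℕ} {p : ℕ} where

  phraseLenUpTo-recurs : ∀ {ℓ} → Recurs s p (suc ℓ) → phraseLenUpTo s p (suc ℓ) ≡ suc ℓ
  phraseLenUpTo-recurs {ℓ} r
    rewrite Equivalence.to T-≡ (Equivalence.from (occursBefore⇔ s _ p) r) = refl

  phraseLenUpTo-skip : ∀ {ℓ} → ¬ Recurs s p (suc ℓ) → phraseLenUpTo s p (suc ℓ) ≡ phraseLenUpTo s p ℓ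
  phraseLenUpTo-skip {ℓ} ¬r with occursBefore s (take (suc ℓ) (drop p s)) p in eq
  ... | false = refl
  ... | true  = ⊥-elim (¬r (Equivalence.to (occursBefore⇔ s _ p) (subst T (sym eq) tt)))

  phraseLenUpTo-above : ∀ {L n} → L ≤′ n → (L < n → ¬ Recurs s p (suc L)) →
                        phraseLenUpTo s p n ≡ phraseLenUpTo s p L
  phraseLenUpTo-above ≤′-refl _ = refl
  phraseLenUpTo-above {L} {suc n} (≤′-step L≤′n) ¬r = begin
    phraseLenUpTo s p (suc n)  ≡⟨ phraseLenUpTo-skip (¬r L<1+n ∘ Recurs-antimono L<1+n) ⟩
    phraseLenUpTo s p n        ≡⟨ phraseLenUpTo-above L≤′n (¬r ∘ m<n⇒m<1+n) ⟩
    phraseLenUpTo s p L        ∎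
    where
    open ≡-Reasoning
    L<1+n : L < suc n
    L<1+n = s≤s (≤′⇒≤ L≤′n)

  phraseLen-fresh : ¬ Recurs s p 1 → phraseLen s p ≡ 1
  phraseLen-fresh ¬r =
    trans (phraseLen-upTo s p) (phraseLenUpTo-above {n = length s ∸ p} (≤⇒≤′ z≤n) (λ _ → ¬r))

  phraseLen-longest : ∀ {ℓ} → suc ℓ ≤ length (drop p s) → Recurs s p (suc ℓ) →
                      (suc ℓ < length (drop p s) → ¬ Recurs s p (suc (suc ℓ))) → phraseLen s p ≡ suc ℓ
  phraseLen-longest {ℓ} fits r maximal rewrite length-drop p s = begin
    phraseLen s p                       ≡⟨ phraseLen-upTo s p ⟩
    phraseLenUpTo s p (length s ∸ p)    ≡⟨ phraseLenUpTo-above (≤⇒≤′ fits) maximal ⟩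
    phraseLenUpTo s p (suc ℓ)           ≡⟨ phraseLenUpTo-recurs r ⟩
    suc ℓ                               ∎
    where open ≡-Reasoning

length-lzFrom-step : ∀ {s p} f → p < length s →
                     length (lzFrom s (suc f) p) ≡ suc (length (lzFrom s f (p + phraseLen s p)))
length-lzFrom-step f p<|s| rewrite Equivalence.to T-≡ (<⇒<ᵇ p<|s|) = refl

lzFrom-end : ∀ s f → lzFrom s f (length s) ≡ []
lzFrom-end s zero = refl
lzFrom-end s (suc f) with length s <ᵇ length s in eq
... | false = refl
... | true  = ⊥-elim (<-irrefl refl (<ᵇ⇒< (length s) (length s) (subst T (sym eq) tt)))

length-lzFrom-uniform : ∀ {s L} a n f → a + n * suc L ≤ length s →
                        (∀ i → i < n → phraseLen s (a + i * suc L) ≡ suc L) →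
                        length (lzFrom s (n + f) a) ≡ n + length (lzFrom s f (a + n * suc L))
length-lzFrom-uniform a zero f _ _ rewrite +-identityʳ a = refl
length-lzFrom-uniform {s} {L} a (suc n) f fits phrases = begin
  length (lzFrom s (suc n + f) a)
    ≡⟨ length-lzFrom-step (n + f) (<-≤-trans (m<m+n a z<s) fits) ⟩
  suc (length (lzFrom s (n + f) (a + phraseLen s a)))
    ≡⟨ cong (λ ℓ → suc (length (lzFrom s (n + f) (a + ℓ)))) first ⟩
  suc (length (lzFrom s (n + f) (a + suc L)))
    ≡⟨ cong suc (length-lzFrom-uniform (a + suc L) n f fits′ phrases′) ⟩
  suc (n + length (lzFrom s f (a + suc L + n * suc L)))
    ≡⟨ cong (λ q → suc (n + length (lzFrom s f q))) (shift n) ⟩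
  suc n + length (lzFrom s f (a + suc n * suc L))
    ∎
  where
  open ≡-Reasoning
  shift : ∀ i → a + suc L + i * suc L ≡ a + suc i * suc L
  shift i = +-assoc a (suc L) (i * suc L)
  first : phraseLen s a ≡ suc L
  first = subst (λ q → phraseLen s q ≡ suc L) (+-identityʳ a) (phrases 0 z<s)
  fits′ : a + suc L + n * suc L ≤ length s
  fits′ = subst (_≤ length s) (sym (shift n)) fits
  phrases′ : ∀ i → i < n → phraseLen s (a + suc L + i * suc L) ≡ suc L
  phrases′ i i<n = subst (λ q → phraseLen s q ≡ suc L) (sym (shift i)) (phrases (suc i) (s<s i<n))

reverse-concatMap : ∀ {A B : Set} (f : A → List B) xs →
                    reverse (concatMap f xs) ≡ concatMap (reverse ∘ f) (reverse xs)
reverse-concatMap f []       = refl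
reverse-concatMap f (x ∷ xs) = begin
  reverse (f x ++ concatMap f xs)                      ≡⟨ reverse-++ (f x) (concatMap f xs) ⟩
  reverse (concatMap f xs) ++ reverse (f x)            ≡⟨ cong (_++ reverse (f x)) (reverse-concatMap f xs) ⟩
  concatMap g (reverse xs) ++ reverse (f x)            ≡⟨ cong (concatMap g (reverse xs) ++_) (++-identityʳ _) ⟨
  concatMap g (reverse xs) ++ concatMap g (x ∷ [])     ≡⟨ concatMap-++ g (reverse xs) (x ∷ []) ⟨
  concatMap g (reverse xs ++ x ∷ [])                   ≡⟨ cong (concatMap g) (unfold-reverse x xs) ⟨
  concatMap g (reverse (x ∷ xs))                       ∎
  where
  open ≡-Reasoning
  g = reverse ∘ f

descendingPairs : ℕ → List ℕ
descendingPairs m = concatMap (λ j → suc (suc j) ∷ suc j ∷ []) (downFrom m)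

wᴿ : ℕ → List ℕ
wᴿ m = applyDownFrom suc (suc m) ++ descendingPairs m

reverse-w : ∀ m → reverse (w (suc m)) ≡ wᴿ m
reverse-w m = begin
  reverse (pairs ++ map suc (upTo (suc m)))
    ≡⟨ reverse-++ pairs (map suc (upTo (suc m))) ⟩
  reverse (map suc (upTo (suc m))) ++ reverse pairs
    ≡⟨ cong (λ l → reverse l ++ reverse pairs) (map-upTo suc (suc m)) ⟩
  reverse (applyUpTo suc (suc m)) ++ reverse pairs
    ≡⟨ cong (_++ reverse pairs) (reverse-applyUpTo suc (suc m)) ⟩
  applyDownFrom suc (suc m) ++ reverse pairs
    ≡⟨ cong (applyDownFrom suc (suc m) ++_) (reverse-concatMap _ (upTo m)) ⟩
  applyDownFrom suc (suc m) ++ concatMap _ (reverse (upTo m))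
    ≡⟨ cong (λ l → applyDownFrom suc (suc m) ++ concatMap _ l) (reverse-upTo m) ⟩
  wᴿ m
    ∎
  where
  open ≡-Reasoning
  pairs = pairsPart (suc m)

length-descendingPairs : ∀ m → length (descendingPairs m) ≡ m * 2
length-descendingPairs zero    = refl
length-descendingPairs (suc m) = cong (suc ∘ suc) (length-descendingPairs m)

length-wᴿ : ∀ m → length (wᴿ m) ≡ suc m + m * 2
length-wᴿ m = begin
  length (applyDownFrom suc (suc m) ++ descendingPairs m)
    ≡⟨ length-++ (applyDownFrom suc (suc m)) ⟩
  length (applyDownFrom suc (suc m)) + length (descendingPairs m)
    ≡⟨ cong₂ _+_ (length-applyDownFrom suc (suc m)) (length-descendingPairs m) ⟩
  suc m + m * 2
    ∎
  where open ≡-Reasoning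

drop-suc : ∀ {A : Set} {x : A} {ys} j (xs : List A) → drop j xs ≡ x ∷ ys → drop (suc j) xs ≡ ys
drop-suc zero    (x ∷ xs) refl = refl
drop-suc (suc j) (_ ∷ xs) eq   = drop-suc j xs eq

<⇒∃-+-suc : ∀ {p n} → p < n → ∃[ k ] p + suc k ≡ n
<⇒∃-+-suc {p} p<n with m≤n⇒∃[o]m+o≡n p<n
... | k , 1+p+k≡n = k , trans (+-suc p k) 1+p+k≡n

drop-applyDownFrom-suc-++ : ∀ i k {n ys} → i + suc k ≡ n →
                            drop i (applyDownFrom suc n ++ ys) ≡ suc k ∷ applyDownFrom suc k ++ ys
drop-applyDownFrom-suc-++ zero    k refl = refl
drop-applyDownFrom-suc-++ (suc i) k refl = drop-applyDownFrom-suc-++ i k refl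

drop-applyDownFrom-++ʳ : ∀ {A : Set} (f : ℕ → A) n j ys →
                         drop (n + j) (applyDownFrom f n ++ ys) ≡ drop j ys
drop-applyDownFrom-++ʳ f zero    j ys = refl
drop-applyDownFrom-++ʳ f (suc n) j ys = drop-applyDownFrom-++ʳ f n j ys

drop-descendingPairs : ∀ k m → k < m → ∃[ c ] k + suc c ≡ m ×
                       drop (k * 2) (descendingPairs m) ≡ suc (suc c) ∷ suc c ∷ descendingPairs c
drop-descendingPairs zero    (suc m) _         = m , refl , refl
drop-descendingPairs (suc k) (suc m) (s<s k<m) with drop-descendingPairs k m k<m
... | c , k+1+c≡m , at-k = c , cong suc k+1+c≡m , at-k

square-descendingPairs : ∀ m i {a u} → drop i (descendingPairs m) ≡ a ∷ a ∷ u →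
                         ∃[ t ] m ≡ t + a × i ≡ suc (t * 2)
square-descendingPairs zero          zero          ()
square-descendingPairs zero          (suc i)       ()
square-descendingPairs (suc m)       zero          ()
square-descendingPairs (suc zero)    (suc zero)    ()
square-descendingPairs (suc (suc m)) (suc zero)    refl = 0 , refl , refl
square-descendingPairs (suc m)       (suc (suc i)) eq with square-descendingPairs m i eq
... | t , m≡t+a , i≡1+2t = suc t , cong suc m≡t+a , cong (suc ∘ suc) i≡1+2t

square-applyDownFrom-suc-++ : ∀ n i {ys a u} → (∀ v → ys ≢ 1 ∷ v) →
                              drop i (applyDownFrom suc n ++ ys) ≡ a ∷ a ∷ u →
                              ∃[ j ] i ≡ n + j × drop j ys ≡ a ∷ a ∷ u
square-applyDownFrom-suc-++ zero          i       _      eq = i , refl , eq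
square-applyDownFrom-suc-++ (suc zero)    zero    ys≢1∷ refl = ⊥-elim (ys≢1∷ _ refl)
square-applyDownFrom-suc-++ (suc (suc n)) zero    _      ()
square-applyDownFrom-suc-++ (suc n)       (suc i) ys≢1∷ eq with square-applyDownFrom-suc-++ n i ys≢1∷ eq
... | j , i≡n+j , at-j = j , cong suc i≡n+j , at-j

descendingPairs-head : ∀ c → 0 < length (descendingPairs c) → ∃[ v ] descendingPairs c ≡ suc c ∷ v
descendingPairs-head (suc c) _ = _ , refl

descendingPairs-≢-1∷ : ∀ m v → descendingPairs m ≢ 1 ∷ v
descendingPairs-≢-1∷ zero    v ()
descendingPairs-≢-1∷ (suc m) v ()

square-wᴿ : ∀ m i {a u} → drop i (wᴿ m) ≡ a ∷ a ∷ u →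
            ∃[ t ] m ≡ t + a × i ≡ suc m + suc (t * 2)
square-wᴿ m i eq with square-applyDownFrom-suc-++ (suc m) i (descendingPairs-≢-1∷ m) eq
... | j , refl , at-j with square-descendingPairs m j at-j
...   | t , m≡t+a , refl = t , m≡t+a , refl

square-wᴿ-unique : ∀ m i i′ {a u u′} →
                   drop i (wᴿ m) ≡ a ∷ a ∷ u → drop i′ (wᴿ m) ≡ a ∷ a ∷ u′ → i ≡ i′
square-wᴿ-unique m i i′ {a} at-i at-i′ with square-wᴿ m i at-i | square-wᴿ m i′ at-i′
... | t , m≡t+a , refl | t′ , m≡t′+a , refl =
  cong (λ t → suc m + suc (t * 2)) (+-cancelʳ-≡ a t t′ (trans (sym m≡t+a) m≡t′+a))

applyDownFrom-suc-++-fresh : ∀ {n p} ys → p < n → ¬ Recurs (applyDownFrom suc n ++ ys) p 1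
applyDownFrom-suc-++-fresh {n} {p} ys p<n (j , j<p , u , at-j)
  with <⇒∃-+-suc p<n | <⇒∃-+-suc (<-trans j<p p<n)
... | k , p+1+k≡n | k′ , j+1+k′≡n = <-irrefl j≡p j<p
  where
  same-letter : suc k′ ≡ suc k
  same-letter = ∷-injectiveˡ (begin
    suc k′ ∷ applyDownFrom suc k′ ++ ys   ≡⟨ drop-applyDownFrom-suc-++ j k′ j+1+k′≡n ⟨
    drop j (applyDownFrom suc n ++ ys)    ≡⟨ at-j ⟩
    take 1 (drop p (applyDownFrom suc n ++ ys)) ++ u
                                          ≡⟨ cong (λ y → take 1 y ++ u) (drop-applyDownFrom-suc-++ p k p+1+k≡n) ⟩
    suc k ∷ u                             ∎)
    where open ≡-Reasoning
  j≡p : j ≡ p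
  j≡p = +-cancelʳ-≡ (suc k) j p (trans (subst (λ x → j + x ≡ n) same-letter j+1+k′≡n) (sym p+1+k≡n))

phraseLen-wᴿ-letter : ∀ {m p} → p < suc m → phraseLen (wᴿ m) p ≡ 1
phraseLen-wᴿ-letter {m} p<1+m = phraseLen-fresh (applyDownFrom-suc-++-fresh (descendingPairs m) p<1+m)

phraseLen-wᴿ-pair : ∀ {m k} → k < m → phraseLen (wᴿ m) (suc m + k * 2) ≡ 2
phraseLen-wᴿ-pair {m} {k} k<m with drop-descendingPairs k m k<m
... | c , k+1+c≡m , pairs-at = phraseLen-longest fits recurs maximal
  where
  s = wᴿ m
  p = suc m + k * 2
  at-p : drop p s ≡ suc (suc c) ∷ suc c ∷ descendingPairs c
  at-p = trans (drop-applyDownFrom-++ʳ suc (suc m) (k * 2) (descendingPairs m)) pairs-at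
  fits : 2 ≤ length (drop p s)
  fits rewrite at-p = s≤s (s≤s z≤n)
  k<p : k < p
  k<p = <-≤-trans (m<n⇒m<1+n k<m) (m≤m+n (suc m) (k * 2))
  at-k : drop k s ≡ suc (suc c) ∷ suc c ∷ applyDownFrom suc c ++ descendingPairs m
  at-k = drop-applyDownFrom-suc-++ k (suc c) (trans (+-suc k (suc c)) (cong suc k+1+c≡m))
  recurs : Recurs s p 2
  recurs rewrite at-p = k , k<p , _ , at-k
  -- The third letter would be c + 1, and the square (c + 1) (c + 1) occurs in s only at p + 1.
  no-triple : (∃[ v ] descendingPairs c ≡ suc c ∷ v) → ¬ Recurs s p 3
  no-triple (v , pairs-c) (j , j<p , u , at-j) =
    <-irrefl (suc-injective (square-wᴿ-unique m (suc j) (suc p) after-j after-p)) j<p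
    where
    at-p′ : drop p s ≡ suc (suc c) ∷ suc c ∷ suc c ∷ v
    at-p′ = trans at-p (cong (λ y → suc (suc c) ∷ suc c ∷ y) pairs-c)
    after-p : drop (suc p) s ≡ suc c ∷ suc c ∷ v
    after-p = drop-suc p s at-p′
    after-j : drop (suc j) s ≡ suc c ∷ suc c ∷ u
    after-j = drop-suc j s (trans at-j (cong (λ y → take 3 y ++ u) at-p′))
  maximal : 2 < length (drop p s) → ¬ Recurs s p 3
  maximal 2<len =
    no-triple (descendingPairs-head c (+-cancelˡ-< 2 0 _ (subst (2 <_) (cong length at-p) 2<len)))

z-wᴿ : ∀ m → z (wᴿ m) ≡ suc m + m
z-wᴿ m = begin
  length (lzFrom s (length s) 0)
    ≡⟨ cong (λ f → length (lzFrom s f 0)) fuel ⟩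
  length (lzFrom s (suc m + (m + m)) 0)
    ≡⟨ length-lzFrom-uniform 0 (suc m) (m + m) letters-fit letters ⟩
  suc m + length (lzFrom s (m + m) (suc m * 1))
    ≡⟨ cong (λ q → suc m + length (lzFrom s (m + m) q)) (*-identityʳ (suc m)) ⟩
  suc m + length (lzFrom s (m + m) (suc m))
    ≡⟨ cong (suc m +_) (length-lzFrom-uniform (suc m) m m pairs-fit pairs) ⟩
  suc m + (m + length (lzFrom s m (suc m + m * 2)))
    ≡⟨ cong (λ q → suc m + (m + length (lzFrom s m q))) (length-wᴿ m) ⟨
  suc m + (m + length (lzFrom s m (length s)))
    ≡⟨ cong (λ l → suc m + (m + length l)) (lzFrom-end s m) ⟩
  suc m + (m + 0)
    ≡⟨ cong (suc m +_) (+-identityʳ m) ⟩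
  suc m + m
    ∎
  where
  open ≡-Reasoning
  s = wᴿ m
  fuel : length s ≡ suc m + (m + m)
  fuel = trans (length-wᴿ m) (cong (suc m +_) (trans (*-comm m 2) (cong (m +_) (+-identityʳ m))))
  letters-fit : suc m * 1 ≤ length s
  letters-fit rewrite *-identityʳ (suc m) | length-wᴿ m = m≤m+n (suc m) (m * 2)
  letters : ∀ i → i < suc m → phraseLen s (i * 1) ≡ 1
  letters i i<1+m rewrite *-identityʳ i = phraseLen-wᴿ-letter i<1+m
  pairs-fit : suc m + m * 2 ≤ length s
  pairs-fit = ≤-reflexive (sym (length-wᴿ m))
  pairs : ∀ k → k < m → phraseLen s (suc m + k * 2) ≡ 2
  pairs k k<m = phraseLen-wᴿ-pair k<m

lemma4p9 : (σ : ℕ) → 2 ≤ σ → 2 ∣ σ → z (reverse (w σ)) ≡ 2 * σ ∸ 1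
lemma4p9 zero    ()  _
lemma4p9 (suc m) _ _ = begin
  z (reverse (w (suc m)))  ≡⟨ cong z (reverse-w m) ⟩
  z (wᴿ m)                 ≡⟨ z-wᴿ m ⟩
  suc m + m                ≡⟨ +-comm (suc m) m ⟩
  m + suc m                ≡⟨ cong (m +_) (sym (+-identityʳ (suc m))) ⟩
  2 * suc m ∸ 1            ∎
  where open ≡-Reasoning
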